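{- Let $x:\mathbb{N}_+\to\mathbb{N}$ be a non-decreasing sequence, and for $s\ge 1$ let $y_s:\mathbb{N}_+\to\mathbb{N}$ be its shift, $y_s(m)=x(s+m)-x(1)$. Then the species $\mathrm{PF}(x)$ of $x$-parking functions satisfies the species isomorphism $$\mathrm{PF}(x)\;\cong\;(E^{x(1)})_0+\sum_{n\ge 1}(E^{x(1)})_n\cdot \mathrm{PF}(y_n).$$ (Equivalently, the family of species $\mathrm{PF}(x)$, $x$ ranging over non-decreasing sequences, is, up to isomorphism, the unique family satisfying this recursion.)
   Context: A species $F$ assigns to each finite set $U$ a finite set $F[U]$ of structures and to each bijection $\sigma:U\to V$ a map $F[\sigma]:F[U]\to F[V]$, functorially. Sum: $(F+G)[U]=F[U]\sqcup G[U]$. Product: $(F\cdot G)[U]=\bigsqcup_{S\sqcup T=U}F[S]\times G[T]$, with transport acting on each component. $F_n$ denotes the restriction of $F$ to sets of cardinality $n$ (empty on other sets). $E$ is the species of sets ($E[U]=\{U\}$); $E^k$ is the $k$-fold product ($E^0=\mathbf{1}$, where $\mathbf{1}[\emptyset]=\{\emptyset\}$ and $\mathbf 1[U]=\emptyset$ otherwise), so an $E^k$-structure on $U$ is a sequence $(Q_1,\dots,Q_k)$ of pairwise disjoint (possibly empty) subsets with union $U$. For a non-decreasing $x:\mathbb{N}_+\to\mathbb{N}$, an $x$-parking function on a finite set $U$ with $|U|=u$ is a sequence $(Q_i)_{i\in\mathbb{N}_+}$ of pairwise disjoint subsets of $U$ with union $U$ such that $\sum_{i=1}^{x(k)}|Q_i|\ge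 k$ for every $1\le k\le u$ (equivalently a map $f:U\to\mathbb{N}_+$, $Q_i=f^{ -1}(i)$, with $|f^{ -1}(\{1,\dots,x(k)\})|\ge k$ for all $k\in[u]$). The species $\mathrm{PF}(x)$ sends $U$ to the set of $x$-parking functions on $U$, and a bijection $\sigma$ acts by $(Q_i)_i\mapsto(\sigma(Q_i))_i$. -}

module Defs where

open import Data.Nat using (ℕ; zero; suc; _+_; _∸_; _≤_; _≤ᵇ_)
open import Data.Bool using (Bool; true; false; _≟_)
open import Data.Fin using (Fin)
import Data.Fin as Fin
open import Data.Unit using (⊤; tt)
open import Data.Empty using (⊥)
open import Data.Sum using (_⊎_; inj₁; inj₂)
open import Data.Product using (Σ; _×_; _,_; proj₁; proj₂)
open import Function using (_∘_)
open import Function.Bundles using (_↔_; Inverse; mk↔ₛ′)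
open import Function.Construct.Composition using (_↔-∘_)
open import Relation.Binary.PropositionalEquality using (_≡_; refl; trans; cong)
open import Axiom.UniquenessOfIdentityProofs using (module Decidable⇒UIP)

open Inverse

-- Species (structures valued in setoids, to avoid function
-- extensionality).  A species assigns to every set U a type of
-- structures with an equality _≈_ on it, and to every bijection
-- σ : U ↔ V a transport map.  (Functoriality laws are facts about the
-- concrete species below and are not needed to state an isomorphism.)

record Species : Set₁ where
  field
    Str : Set → Set
    _≈_ : ∀ {U} → Str U → Str U → Set
    tr  : ∀ {U V : Set} → U ↔ V → Str U → Str V

open Species public

record FinSet : Set₁ where
  field
    Car  : Set
    size : ℕ
    enum : Fin size ↔ Car

open FinSet public

record _≅ˢ_ (F G : Species) : Set₁ where
  field
    φ     : (U : FinSet) → Str F (Car U) → Str G (Car U)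
    ψ     : (U : FinSet) → Str G (Car U) → Str F (Car U)
    φ-cong : ∀ U {s s'} → _≈_ F s s' → _≈_ G (φ U s) (φ U s')
    ψ-cong : ∀ U {t t'} → _≈_ G t t' → _≈_ F (ψ U t) (ψ U t')
    ψφ    : ∀ U s → _≈_ F (ψ U (φ U s)) s
    φψ    : ∀ U t → _≈_ G (φ U (ψ U t)) t
    natural : ∀ U V (σ : Car U ↔ Car V) (s : Str F (Car U)) →
              _≈_ G (φ V (tr F σ s)) (tr G σ (φ U s))

-- Subsets of U are given by characteristic functions P : U → Bool;
-- Sub U P b is the subset where P takes the value b.

Sub : (U : Set) → (U → Bool) → Bool → Set
Sub U P b = Σ U (λ a → P a ≡ b)

open Decidable⇒UIP _≟_ renaming (≡-irrelevant to Bool-UIP)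

Sub-≡ : ∀ {U : Set} {P : U → Bool} {b} {a a' : U} {p : P a ≡ b} {p' : P a' ≡ b} →
        a ≡ a' → _≡_ {A = Sub U P b} (a , p) (a' , p')
Sub-≡ {a = a} {p = p} {p' = p'} refl = cong (a ,_) (Bool-UIP p p')

subTr : ∀ {U V : Set} (σ : U ↔ V) (P : U → Bool) (b : Bool) →
        Sub U P b ↔ Sub V (P ∘ from σ) b
subTr σ P b = mk↔ₛ′ t f
  (λ { (v , q) → Sub-≡ (strictlyInverseˡ σ v) })
  (λ { (a , p) → Sub-≡ (strictlyInverseʳ σ a) })
  where
  t : Sub _ P b → Sub _ (P ∘ from σ) b
  t (a , p) = to σ a , trans (cong P (strictlyInverseʳ σ a)) p
  f : Sub _ (P ∘ from σ) b → Sub _ P b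
  f (v , q) = from σ v , q

subEq : ∀ {U : Set} {P Q : U → Bool} (b : Bool) → (∀ a → P a ≡ Q a) →
        Sub U P b ↔ Sub U Q b
subEq {P = P} {Q} b e = mk↔ₛ′ t f
  (λ { (a , q) → Sub-≡ refl })
  (λ { (a , p) → Sub-≡ refl })
  where
  t : Sub _ P b → Sub _ Q b
  t (a , p) = a , trans (Relation.Binary.PropositionalEquality.sym (e a)) p
  f : Sub _ Q b → Sub _ P b
  f (a , q) = a , trans (e a) q

_⊕_ : Species → Species → Species
Str (F ⊕ G) U = Str F U ⊎ Str G U
_≈_ (F ⊕ G) (inj₁ s) (inj₁ s') = _≈_ F s s'
_≈_ (F ⊕ G) (inj₁ _) (inj₂ _)  = ⊥
_≈_ (F ⊕ G) (inj₂ _) (inj₁ _)  = ⊥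
_≈_ (F ⊕ G) (inj₂ t) (inj₂ t') = _≈_ G t t'
tr (F ⊕ G) σ (inj₁ s) = inj₁ (tr F σ s)
tr (F ⊕ G) σ (inj₂ t) = inj₂ (tr G σ t)

data ΣRel (F : ℕ → Species) {U : Set} :
          Σ ℕ (λ m → Str (F m) U) → Σ ℕ (λ m → Str (F m) U) → Set where
  same : ∀ {m s s'} → _≈_ (F m) s s' → ΣRel F (m , s) (m , s')

⨁ : (ℕ → Species) → Species
Str (⨁ F) U = Σ ℕ (λ m → Str (F m) U)
_≈_ (⨁ F) = ΣRel F
tr (⨁ F) σ (m , s) = m , tr (F m) σ s

-- product F · G : a decomposition U = S ⊔ T (S = P⁻¹ true,
-- T = P⁻¹ false), an F-structure on S and a G-structure on T.
_⊙_ : Species → Species → Species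
Str (F ⊙ G) U = Σ (U → Bool) (λ P → Str F (Sub U P true) × Str G (Sub U P false))
_≈_ (F ⊙ G) (P , s , t) (P' , s' , t') =
  Σ (∀ a → P a ≡ P' a) (λ e →
      _≈_ F (tr F (subEq true e) s) s' × _≈_ G (tr G (subEq false e) t) t')
tr (F ⊙ G) σ (P , s , t) = P ∘ from σ , tr F (subTr σ P true) s , tr G (subTr σ P false) t

-- restriction F_n : F-structures on sets of cardinality n
Restr : Species → ℕ → Species
Str (Restr F n) U = (Fin n ↔ U) × Str F U
_≈_ (Restr F n) (_ , s) (_ , s') = _≈_ F s s'
tr (Restr F n) σ (e , s) = σ ↔-∘ e , tr F σ s

𝟏 : Species
Str 𝟏 U = U → ⊥
_≈_ 𝟏 _ _ = ⊤
tr 𝟏 σ f = f ∘ from σ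

𝐄 : Species
Str 𝐄 U = ⊤
_≈_ 𝐄 _ _ = ⊤
tr 𝐄 σ _ = tt

Epow : ℕ → Species
Epow zero    = 𝟏
Epow (suc k) = 𝐄 ⊙ Epow k

-- x-parking functions.  A sequence ℕ₊ → ℕ is represented by a function
-- x : ℕ → ℕ whose value at 0 is ignored.

NonDecreasing : (ℕ → ℕ) → Set
NonDecreasing x = ∀ {m n} → 1 ≤ m → m ≤ n → x m ≤ x n

countFin : (n : ℕ) → (Fin n → Bool) → ℕ
countFin zero    p = 0
countFin (suc n) p with p Fin.zero
... | true  = suc (countFin n (p ∘ Fin.suc))
... | false = countFin n (p ∘ Fin.suc)

IsParking : (x : ℕ → ℕ) {U : Set} → (U → ℕ) → Set
IsParking x {U} f =
  (∀ a → 1 ≤ f a) ×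
  (∀ u (e : Fin u ↔ U) (k : ℕ) → 1 ≤ k → k ≤ u →
     k ≤ countFin u (λ i → f (to e i) ≤ᵇ x k))

PF : (ℕ → ℕ) → Species
Str (PF x) U = Σ (U → ℕ) (IsParking x)
_≈_ (PF x) (f , _) (g , _) = ∀ a → f a ≡ g a
tr (PF x) σ (f , ok) = f ∘ from σ , pos , cnt
  where
  pos : ∀ b → 1 ≤ f (from σ b)
  pos b = proj₁ ok (from σ b)
  cnt : ∀ u (e : Fin u ↔ _) (k : ℕ) → 1 ≤ k → k ≤ u →
        k ≤ countFin u (λ i → f (from σ (to e i)) ≤ᵇ x k)
  cnt u e k = proj₂ ok u (↔-sym' σ ↔-∘ e) k
    where
    ↔-sym' : ∀ {A B : Set} → A ↔ B → B ↔ A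
    ↔-sym' τ = mk↔ₛ′ (from τ) (to τ) (strictlyInverseʳ τ) (strictlyInverseˡ τ)

shift : (ℕ → ℕ) → ℕ → (ℕ → ℕ)
shift x s m = x (s + m) ∸ x 1

-- Split an x-parking function f at the threshold x(1).  On the low block
-- S = f⁻¹{1,…,x(1)} the values of f form an E^{x(1)}-structure.  For k ≥ 1 every
-- point of S is counted in |f⁻¹{1,…,x(k)}|, since x(1) ≤ x(k); so with s = |S| and
-- g = f − x(1) on the high block, |f⁻¹{1,…,x(s+k)}| = s + |g⁻¹{1,…,y_s(k)}|.  Hence the
-- parking condition for f at s + k is the one for g at k, while for k ≤ s it holds
-- automatically.  At k = 1 it forces S ≠ ∅ unless U = ∅, which gives the summand (E^{x(1)})₀.
module Submission where

open import Defs
open import Data.Nat using (ℕ; zero; suc; _+_; _∸_; _≤_; _<_; _≤ᵇ_; z≤n; s≤s; _≤?_)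
open import Data.Nat.Properties
open import Data.Bool using (Bool; true; false; not; T; if_then_else_)
open import Data.Bool.Properties using (not-involutive)
open import Data.Fin using (Fin; splitAt) renaming (zero to fzero; suc to fsuc)
open import Data.Fin.Properties using (¬Fin0; +↔⊎)
open import Data.Fin.Permutation using (↔⇒≡)
open import Data.Empty using (⊥-elim)
open import Data.Sum using (_⊎_; inj₁; inj₂; [_,_]′; map; map₁)
open import Data.Sum.Function.Propositional using (_⊎-cong_)
open import Data.Product using (_,_; proj₁; proj₂)
open import Data.Unit using (tt)
open import Function using (_∘_; const)
open import Function.Bundles using (_↔_; Inverse; mk↔ₛ′)
open import Function.Construct.Composition using (_↔-∘_)
open import Function.Construct.Symmetry using (↔-sym)
open import Relation.Binary.PropositionalEquality
open import Relation.Nullary using (¬_; yes; no; contradiction)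
open import Algebra.Properties.CommutativeMonoid.Sum +-0-commutativeMonoid
  using (sum; sum-permute; sum-cong-≗)

open Inverse

≤⇒≤ᵇ≡true : ∀ {m n} → m ≤ n → (m ≤ᵇ n) ≡ true
≤⇒≤ᵇ≡true {m} {n} m≤n with m ≤ᵇ n | ≤⇒≤ᵇ m≤n
... | true | _ = refl

≤ᵇ≡true⇒≤ : ∀ {m n} → (m ≤ᵇ n) ≡ true → m ≤ n
≤ᵇ≡true⇒≤ {m} {n} eq = ≤ᵇ⇒≤ m n (subst T (sym eq) tt)

>⇒≤ᵇ≡false : ∀ {m n} → n < m → (m ≤ᵇ n) ≡ false
>⇒≤ᵇ≡false {m} {n} n<m with m ≤ᵇ n in eq
... | true  = contradiction (≤ᵇ≡true⇒≤ eq) (<⇒≱ n<m)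
... | false = refl

≤ᵇ≡false⇒> : ∀ {m n} → (m ≤ᵇ n) ≡ false → n < m
≤ᵇ≡false⇒> eq = ≰⇒> (λ m≤n → contradiction (trans (sym eq) (≤⇒≤ᵇ≡true m≤n)) λ ())

≤ᵇ-∸ : ∀ {a t o} → o ≤ t → (a ≤ᵇ t) ≡ (a ∸ o ≤ᵇ t ∸ o)
≤ᵇ-∸ {a} {t} {o} o≤t with a ≤? t
... | yes a≤t = trans (≤⇒≤ᵇ≡true a≤t) (sym (≤⇒≤ᵇ≡true (∸-monoˡ-≤ o a≤t)))
... | no  a≰t = trans (>⇒≤ᵇ≡false t<a) (sym (>⇒≤ᵇ≡false (∸-monoˡ-< t<a o≤t)))
  where
  t<a : t < a
  t<a = ≰⇒> a≰t

χ : Bool → ℕ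
χ b = if b then 1 else 0

countFin-suc : ∀ n (p : Fin (suc n) → Bool) → countFin (suc n) p ≡ χ (p fzero) + countFin n (p ∘ fsuc)
countFin-suc n p with p fzero
... | true  = refl
... | false = refl

countFin≡sum : ∀ n (p : Fin n → Bool) → countFin n p ≡ sum (χ ∘ p)
countFin≡sum zero    p = refl
countFin≡sum (suc n) p = trans (countFin-suc n p) (cong (χ (p fzero) +_) (countFin≡sum n (p ∘ fsuc)))

countFin-cong : ∀ n {p q : Fin n → Bool} → (∀ i → p i ≡ q i) → countFin n p ≡ countFin n q
countFin-cong n {p} {q} p≗q =
  trans (countFin≡sum n p) (trans (sum-cong-≗ (cong χ ∘ p≗q)) (sym (countFin≡sum n q)))

countFin-true : ∀ n (p : Fin n → Bool) → (∀ i → p i ≡ true) → countFin n p ≡ n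
countFin-true zero    p _     = refl
countFin-true (suc n) p all-p =
  trans (countFin-suc n p) (cong₂ _+_ (cong χ (all-p fzero)) (countFin-true n (p ∘ fsuc) (all-p ∘ fsuc)))

countFin-↔ : ∀ {A : Set} {u u'} (e : Fin u ↔ A) (e' : Fin u' ↔ A) (q : A → Bool) →
             countFin u (q ∘ to e) ≡ countFin u' (q ∘ to e')
countFin-↔ {u = u} {u'} e e' q = begin
  countFin u (q ∘ to e)      ≡⟨ countFin≡sum u _ ⟩
  sum (χ ∘ q ∘ to e)         ≡⟨ sum-cong-≗ (cong (χ ∘ q) ∘ sym ∘ strictlyInverseˡ e' ∘ to e) ⟩
  sum (χ ∘ q ∘ to e' ∘ to π) ≡⟨ sym (sum-permute (χ ∘ q ∘ to e') π) ⟩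
  sum (χ ∘ q ∘ to e')        ≡⟨ sym (countFin≡sum u' _) ⟩
  countFin u' (q ∘ to e')    ∎
  where
  open ≡-Reasoning
  π : Fin u ↔ Fin u'
  π = ↔-sym e' ↔-∘ e

countFin-splitAt : ∀ c d (h : Fin c ⊎ Fin d → Bool) →
  countFin (c + d) (h ∘ splitAt c) ≡ countFin c (h ∘ inj₁) + countFin d (h ∘ inj₂)
countFin-splitAt zero    d h = refl
countFin-splitAt (suc c) d h = begin
  countFin (suc c + d) (h ∘ splitAt (suc c))
    ≡⟨ countFin-suc (c + d) (h ∘ splitAt (suc c)) ⟩
  χ (h (inj₁ fzero)) + countFin (c + d) (h ∘ map₁ fsuc ∘ splitAt c)
    ≡⟨ cong (χ (h (inj₁ fzero)) +_) (countFin-splitAt c d (h ∘ map₁ fsuc)) ⟩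
  χ (h (inj₁ fzero)) + (countFin c (h ∘ inj₁ ∘ fsuc) + countFin d (h ∘ inj₂))
    ≡⟨ sym (+-assoc (χ (h (inj₁ fzero))) _ _) ⟩
  (χ (h (inj₁ fzero)) + countFin c (h ∘ inj₁ ∘ fsuc)) + countFin d (h ∘ inj₂)
    ≡⟨ cong (_+ countFin d (h ∘ inj₂)) (sym (countFin-suc c (h ∘ inj₁))) ⟩
  countFin (suc c) (h ∘ inj₁) + countFin d (h ∘ inj₂)
    ∎
  where open ≡-Reasoning

true-or-false : ∀ b → b ≡ true ⊎ b ≡ false
true-or-false true  = inj₁ refl
true-or-false false = inj₂ refl

-- Case splits on P a go through true-or-false rather than `with P a`: a goal
-- mentioning split normalises to one containing the refl passed to splitWith,
-- and abstracting P a there is ill-typed.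
module _ {A : Set} (P : A → Bool) where

  splitWith : ∀ a b → P a ≡ b → Sub A P true ⊎ Sub A P false
  splitWith a true  p = inj₁ (a , p)
  splitWith a false p = inj₂ (a , p)

  split : A → Sub A P true ⊎ Sub A P false
  split a = splitWith a (P a) refl

  split-true : ∀ {a} (p : P a ≡ true) → split a ≡ inj₁ (a , p)
  split-true {a} p = go (P a) refl
    where
    go : ∀ b (q : P a ≡ b) → splitWith a b q ≡ inj₁ (a , p)
    go true  q = cong inj₁ (Sub-≡ refl)
    go false q = contradiction (trans (sym q) p) λ ()

  split-false : ∀ {a} (p : P a ≡ false) → split a ≡ inj₂ (a , p)
  split-false {a} p = go (P a) refl
    where
    go : ∀ b (q : P a ≡ b) → splitWith a b q ≡ inj₂ (a , p)
    go true  q = contradiction (trans (sym q) p) λ ()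
    go false q = cong inj₂ (Sub-≡ refl)

  partition : A ↔ (Sub A P true ⊎ Sub A P false)
  partition = mk↔ₛ′ split [ proj₁ , proj₁ ]′ split-proj₁ proj₁-split
    where
    split-proj₁ : ∀ s → split ([ proj₁ , proj₁ ]′ s) ≡ s
    split-proj₁ (inj₁ (a , p)) = split-true p
    split-proj₁ (inj₂ (a , p)) = split-false p
    proj₁-split : ∀ a → [ proj₁ , proj₁ ]′ (split a) ≡ a
    proj₁-split a with true-or-false (P a)
    ... | inj₁ p = cong [ proj₁ , proj₁ ]′ (split-true p)
    ... | inj₂ p = cong [ proj₁ , proj₁ ]′ (split-false p)

Sub-not : ∀ {A : Set} (P : A → Bool) → Sub A (not ∘ P) true ↔ Sub A P false
Sub-not P = mk↔ₛ′ (λ (a , p) → a , trans (sym (not-involutive (P a))) (cong not p))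
                  (λ (a , p) → a , cong not p)
                  (λ _ → Sub-≡ refl) (λ _ → Sub-≡ refl)

enumSub : ∀ u (Q : Fin u → Bool) → Fin (countFin u Q) ↔ Sub (Fin u) Q true
enumSub zero    Q = mk↔ₛ′ (λ ()) (λ { (() , _) }) (λ { (() , _) }) (λ ())
enumSub (suc u) Q with Q fzero in Q₀
... | true  = mk↔ₛ′ to′ from′ to∘from from∘to
  where
  e : Fin (countFin u (Q ∘ fsuc)) ↔ Sub (Fin u) (Q ∘ fsuc) true
  e = enumSub u (Q ∘ fsuc)
  to′ : Fin (suc (countFin u (Q ∘ fsuc))) → Sub (Fin (suc u)) Q true
  to′ fzero    = fzero , Q₀
  to′ (fsuc i) = fsuc (proj₁ (to e i)) , proj₂ (to e i)
  from′ : Sub (Fin (suc u)) Q true → Fin (suc (countFin u (Q ∘ fsuc)))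
  from′ (fzero  , _) = fzero
  from′ (fsuc j , p) = fsuc (from e (j , p))
  to∘from : ∀ s → to′ (from′ s) ≡ s
  to∘from (fzero  , _) = Sub-≡ refl
  to∘from (fsuc j , p) = cong (λ (i , q) → fsuc i , q) (strictlyInverseˡ e (j , p))
  from∘to : ∀ i → from′ (to′ i) ≡ i
  from∘to fzero    = refl
  from∘to (fsuc i) = cong fsuc (strictlyInverseʳ e i)
... | false = mk↔ₛ′ to′ from′ to∘from (strictlyInverseʳ e)
  where
  e : Fin (countFin u (Q ∘ fsuc)) ↔ Sub (Fin u) (Q ∘ fsuc) true
  e = enumSub u (Q ∘ fsuc)
  to′ : Fin (countFin u (Q ∘ fsuc)) → Sub (Fin (suc u)) Q true
  to′ i = fsuc (proj₁ (to e i)) , proj₂ (to e i)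
  from′ : Sub (Fin (suc u)) Q true → Fin (countFin u (Q ∘ fsuc))
  from′ (fzero  , p) = contradiction (trans (sym Q₀) p) λ ()
  from′ (fsuc j , p) = from e (j , p)
  to∘from : ∀ s → to′ (from′ s) ≡ s
  to∘from (fzero  , p) = contradiction (trans (sym Q₀) p) λ ()
  to∘from (fsuc j , p) = cong (λ (i , q) → fsuc i , q) (strictlyInverseˡ e (j , p))

enumSub-true : ∀ {A : Set} {u} (e : Fin u ↔ A) (P : A → Bool) →
               Fin (countFin u (P ∘ to e)) ↔ Sub A P true
enumSub-true {u = u} e P = ↔-sym (subTr (↔-sym e) P true) ↔-∘ enumSub u (P ∘ to e)

enumSub-false : ∀ {A : Set} {u} (e : Fin u ↔ A) (P : A → Bool) →
                Fin (countFin u (not ∘ P ∘ to e)) ↔ Sub A P false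
enumSub-false e P = Sub-not P ↔-∘ enumSub-true e (not ∘ P)

module _ {A : Set} (P : A → Bool) {s d} (eS : Fin s ↔ Sub A P true) (eT : Fin d ↔ Sub A P false) where

  joinEnum : Fin (s + d) ↔ A
  joinEnum = ↔-sym (partition P) ↔-∘ ((eS ⊎-cong eT) ↔-∘ +↔⊎)

  size-partition : ∀ {u} → Fin u ↔ A → u ≡ s + d
  size-partition e = ↔⇒≡ (↔-sym joinEnum ↔-∘ e)

  countFin-partition : ∀ {u} (e : Fin u ↔ A) (q : A → Bool) → (∀ c → q (proj₁ c) ≡ true) →
    countFin u (q ∘ to e) ≡ s + countFin d (q ∘ proj₁ ∘ to eT)
  countFin-partition {u} e q q-true = begin
    countFin u (q ∘ to e)
      ≡⟨ countFin-↔ e joinEnum q ⟩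
    countFin (s + d) (q ∘ to joinEnum)
      ≡⟨ countFin-splitAt s d (q ∘ [ proj₁ , proj₁ ]′ ∘ map (to eS) (to eT)) ⟩
    countFin s (q ∘ proj₁ ∘ to eS) + countFin d (q ∘ proj₁ ∘ to eT)
      ≡⟨ cong (_+ countFin d (q ∘ proj₁ ∘ to eT)) (countFin-true s _ (q-true ∘ to eS)) ⟩
    s + countFin d (q ∘ proj₁ ∘ to eT)
      ∎
    where open ≡-Reasoning

-- An E^k-structure is a first block Q₁ together with an E^(k-1)-structure on the
-- complement of Q₁; decode sends the points of the i-th block to i.
decode : ∀ k {A : Set} → Str (Epow k) A → A → ℕ
decode zero    s           a = ⊥-elim (s a)
decode (suc k) (Q , _ , r) a = [ const 1 , suc ∘ decode k r ]′ (split Q a)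

module _ k {A : Set} (s : Str (Epow (suc k)) A) where

  decode-first : ∀ {a} → proj₁ s a ≡ true → decode (suc k) s a ≡ 1
  decode-first p = cong [ const 1 , suc ∘ decode k (proj₂ (proj₂ s)) ]′ (split-true (proj₁ s) p)

  decode-later : ∀ {a} (p : proj₁ s a ≡ false) →
                 decode (suc k) s a ≡ suc (decode k (proj₂ (proj₂ s)) (a , p))
  decode-later p = cong [ const 1 , suc ∘ decode k (proj₂ (proj₂ s)) ]′ (split-false (proj₁ s) p)

decode-positive : ∀ k {A : Set} (s : Str (Epow k) A) a → 1 ≤ decode k s a
decode-positive zero    s             a = ⊥-elim (s a)
decode-positive (suc k) s@(Q , _ , r) a with true-or-false (Q a)
... | inj₁ p rewrite decode-first k s p = ≤-refl
... | inj₂ p rewrite decode-later k s p = s≤s z≤n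

decode-≤ : ∀ k {A : Set} (s : Str (Epow k) A) a → decode k s a ≤ k
decode-≤ zero    s             a = ⊥-elim (s a)
decode-≤ (suc k) s@(Q , _ , r) a with true-or-false (Q a)
... | inj₁ p rewrite decode-first k s p = s≤s z≤n
... | inj₂ p rewrite decode-later k s p = s≤s (decode-≤ k r (a , p))

decode-tr : ∀ k {A B : Set} (σ : A ↔ B) (s : Str (Epow k) A) b →
            decode k (tr (Epow k) σ s) b ≡ decode k s (from σ b)
decode-tr zero    σ s             b = ⊥-elim (s (from σ b))
decode-tr (suc k) σ s@(Q , _ , r) b with true-or-false (Q (from σ b))
... | inj₁ p = trans (decode-first k (tr (Epow (suc k)) σ s) p) (sym (decode-first k s p))
... | inj₂ p = trans (decode-later k (tr (Epow (suc k)) σ s) p)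
                 (trans (cong suc (decode-tr k (subTr σ Q false) r (b , p))) (sym (decode-later k s p)))

encode : ∀ k {A : Set} (h : A → ℕ) → (∀ a → 1 ≤ h a) → (∀ a → h a ≤ k) → Str (Epow k) A
encode zero    h pos h≤k a = contradiction (≤-trans (pos a) (h≤k a)) λ ()
encode (suc k) {A} h pos h≤k = Q , tt , encode k (λ c → h (proj₁ c) ∸ 1) pos′ h≤k′
  where
  Q : A → Bool
  Q a = h a ≤ᵇ 1
  pos′ : ∀ (c : Sub A Q false) → 1 ≤ h (proj₁ c) ∸ 1
  pos′ (a , p) = m<n⇒0<n∸m (≤ᵇ≡false⇒> {h a} p)
  h≤k′ : ∀ (c : Sub A Q false) → h (proj₁ c) ∸ 1 ≤ k
  h≤k′ (a , _) = ∸-monoˡ-≤ 1 (h≤k a)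

decode-encode : ∀ k {A : Set} (h : A → ℕ) pos h≤k a → decode k (encode k h pos h≤k) a ≡ h a
decode-encode zero    h pos h≤k a = contradiction (≤-trans (pos a) (h≤k a)) λ ()
decode-encode (suc k) h pos h≤k a with true-or-false (h a ≤ᵇ 1)
... | inj₁ p = trans (decode-first k (encode (suc k) h pos h≤k) p) (≤-antisym (pos a) (≤ᵇ≡true⇒≤ p))
... | inj₂ p = trans (decode-later k (encode (suc k) h pos h≤k) p)
                 (trans (cong suc (decode-encode k _ _ _ (a , p))) (m+[n∸m]≡n (pos a)))

first-block : ∀ k {A : Set} (s : Str (Epow (suc k)) A) a → proj₁ s a ≡ (decode (suc k) s a ≤ᵇ 1)
first-block k s@(Q , _ , r) a with true-or-false (Q a)
... | inj₁ p rewrite decode-first k s p = p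
... | inj₂ p rewrite decode-later k s p = trans p (sym (>⇒≤ᵇ≡false (s≤s (decode-positive k r (a , p)))))

≈⇒decode≡ : ∀ k {A : Set} {s s' : Str (Epow k) A} → _≈_ (Epow k) s s' → ∀ a → decode k s a ≡ decode k s' a
≈⇒decode≡ zero    {s = s} _ a = ⊥-elim (s a)
≈⇒decode≡ (suc k) {s = s@(Q , _ , r)} {s'@(Q' , _ , r')} (Q≗Q' , _ , r≈r') a with true-or-false (Q a)
... | inj₁ p = trans (decode-first k s p) (sym (decode-first k s' (trans (sym (Q≗Q' a)) p)))
... | inj₂ p = trans (decode-later k s p) (trans (cong suc later) (sym (decode-later k s' p')))
  where
  p' : Q' a ≡ false
  p' = trans (sym (Q≗Q' a)) p
  later : decode k r (a , p) ≡ decode k r' (a , p')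
  later = trans (cong (decode k r) (Sub-≡ refl))
                (trans (sym (decode-tr k (subEq false Q≗Q') r (a , p'))) (≈⇒decode≡ k r≈r' (a , p')))

decode≡⇒≈ : ∀ k {A : Set} (s s' : Str (Epow k) A) → (∀ a → decode k s a ≡ decode k s' a) →
            _≈_ (Epow k) s s'
decode≡⇒≈ zero    s               s'                 _    = tt
decode≡⇒≈ (suc k) s@(Q , _ , r) s'@(Q' , _ , r') s≗s' = Q≗Q' , tt , decode≡⇒≈ k _ r' later≗
  where
  Q≗Q' : ∀ a → Q a ≡ Q' a
  Q≗Q' a = trans (first-block k s a) (trans (cong (_≤ᵇ 1) (s≗s' a)) (sym (first-block k s' a)))
  later≗ : ∀ c → decode k (tr (Epow k) (subEq false Q≗Q') r) c ≡ decode k r' c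
  later≗ (a , p) = trans (decode-tr k (subEq false Q≗Q') r (a , p)) (suc-injective (begin
    suc (decode k r (a , trans (Q≗Q' a) p)) ≡⟨ decode-later k s _ ⟨
    decode (suc k) s a                       ≡⟨ s≗s' a ⟩
    decode (suc k) s' a                      ≡⟨ decode-later k s' p ⟩
    suc (decode k r' (a , p))                ∎))
    where open ≡-Reasoning

Epow-empty : ∀ k {A : Set} → ¬ A → Str (Epow k) A
Epow-empty k ¬A = encode k (λ a → ⊥-elim (¬A a)) (λ a → ⊥-elim (¬A a)) (λ a → ⊥-elim (¬A a))

≈-empty : ∀ k {A : Set} → ¬ A → (s s' : Str (Epow k) A) → _≈_ (Epow k) s s'
≈-empty k ¬A s s' = decode≡⇒≈ k s s' (λ a → ⊥-elim (¬A a))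

IsParking-cong : ∀ {y : ℕ → ℕ} {A : Set} {f g : A → ℕ} → (∀ a → f a ≡ g a) →
                 IsParking y f → IsParking y g
IsParking-cong {y} f≗g (pos , count) =
  (λ a → subst (1 ≤_) (f≗g a) (pos a)) ,
  λ u e k 1≤k k≤u → subst (k ≤_) (countFin-cong u (λ i → cong (_≤ᵇ y k) (f≗g (to e i))))
                                  (count u e k 1≤k k≤u)

empty-parking : ∀ (y : ℕ → ℕ) {A : Set} → ¬ A → Str (PF y) A
empty-parking y {A} ¬A = f , (λ a → ⊥-elim (¬A a)) , count
  where
  f : A → ℕ
  f a = ⊥-elim (¬A a)
  count : ∀ u (e : Fin u ↔ A) k → 1 ≤ k → k ≤ u → k ≤ countFin u (λ i → f (to e i) ≤ᵇ y k)
  count zero    e k 1≤k k≤0 = contradiction (≤-trans 1≤k k≤0) λ ()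
  count (suc u) e k _   _   = ⊥-elim (¬A (to e fzero))

Fin0↔ : ∀ {A : Set} → ¬ A → Fin 0 ↔ A
Fin0↔ ¬A = mk↔ₛ′ (λ ()) (λ a → ⊥-elim (¬A a)) (λ a → ⊥-elim (¬A a)) (λ ())

module Parking (x : ℕ → ℕ) (mono : NonDecreasing x) where

  x₁ : ℕ
  x₁ = x 1

  x₁≤x : ∀ {k} → 1 ≤ k → x₁ ≤ x k
  x₁≤x 1≤k = mono ≤-refl 1≤k

  -- The low block P is a parameter, pinned down by P≡low, so that the same lemmas
  -- serve both for splitting a parking function and for gluing a given decomposition.
  module Threshold {A : Set} (f : A → ℕ) (P : A → Bool) (P≡low : ∀ a → (f a ≤ᵇ x₁) ≡ P a) where

    high : Sub A P false → ℕ
    high c = f (proj₁ c) ∸ x₁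

    low≤ : ∀ (c : Sub A P true) → f (proj₁ c) ≤ x₁
    low≤ (a , p) = ≤ᵇ≡true⇒≤ (trans (P≡low a) p)

    high> : ∀ (c : Sub A P false) → x₁ < f (proj₁ c)
    high> (a , p) = ≤ᵇ≡false⇒> (trans (P≡low a) p)

    countFin-shift : ∀ {s d u} (eS : Fin s ↔ Sub A P true) (eT : Fin d ↔ Sub A P false) (e : Fin u ↔ A) →
                     ∀ k → 1 ≤ k →
                     countFin u (λ i → f (to e i) ≤ᵇ x k) ≡ s + countFin d (λ i → high (to eT i) ≤ᵇ x k ∸ x₁)
    countFin-shift {s} {d} eS eT e k 1≤k =
      trans (countFin-partition P eS eT e (λ a → f a ≤ᵇ x k) low-counted)
            (cong (s +_) (countFin-cong d (λ i → ≤ᵇ-∸ {f (proj₁ (to eT i))} (x₁≤x 1≤k))))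
      where
      low-counted : ∀ (c : Sub A P true) → (f (proj₁ c) ≤ᵇ x k) ≡ true
      low-counted c = ≤⇒≤ᵇ≡true (≤-trans (low≤ c) (x₁≤x 1≤k))

    parking⇒high-parking : ∀ {s} → Fin s ↔ Sub A P true → IsParking x f → IsParking (shift x s) high
    parking⇒high-parking {s} eS (_ , count) = (λ c → m<n⇒0<n∸m (high> c)) , count-high
      where
      count-high : ∀ d (eT : Fin d ↔ Sub A P false) k → 1 ≤ k → k ≤ d →
                   k ≤ countFin d (λ i → high (to eT i) ≤ᵇ shift x s k)
      count-high d eT k 1≤k k≤d = +-cancelˡ-≤ s k _
        (subst (s + k ≤_) (countFin-shift eS eT (joinEnum P eS eT) (s + k) 1≤s+k)
               (count (s + d) (joinEnum P eS eT) (s + k) 1≤s+k (+-monoʳ-≤ s k≤d)))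
        where
        1≤s+k : 1 ≤ s + k
        1≤s+k = ≤-trans 1≤k (m≤n+m k s)

    high-parking⇒parking : ∀ {s} → Fin s ↔ Sub A P true → (∀ a → 1 ≤ f a) → IsParking (shift x s) high →
                    IsParking x f
    high-parking⇒parking {s} eS pos (_ , count-high) = pos , λ u e → count u e (enumSub-false e P)
      where
      count : ∀ u (e : Fin u ↔ A) {d} (eT : Fin d ↔ Sub A P false) k → 1 ≤ k → k ≤ u →
              k ≤ countFin u (λ i → f (to e i) ≤ᵇ x k)
      count u e {d} eT k 1≤k k≤u with k ≤? s
      ... | yes k≤s = ≤-trans k≤s (subst (s ≤_) (sym (countFin-shift eS eT e k 1≤k)) (m≤m+n s _))
      ... | no  k≰s = subst (λ k → k ≤ countFin u (λ i → f (to e i) ≤ᵇ x k)) (m+[n∸m]≡n (<⇒≤ s<k))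
          (subst (s + j ≤_) (sym (countFin-shift eS eT e (s + j) (≤-trans 1≤j (m≤n+m j s))))
                 (+-monoʳ-≤ s (count-high d eT j 1≤j j≤d)))
        where
        s<k : s < k
        s<k = ≰⇒> k≰s
        j : ℕ
        j = k ∸ s
        1≤j : 1 ≤ j
        1≤j = m<n⇒0<n∸m s<k
        j≤d : j ≤ d
        j≤d = subst (j ≤_) (trans (cong (_∸ s) (size-partition P eS eT e)) (m+n∸m≡n s d))
                           (∸-monoˡ-≤ s k≤u)

  Decomposed : Species
  Decomposed = Restr (Epow x₁) 0 ⊕ ⨁ (λ m → Restr (Epow x₁) (suc m) ⊙ PF (shift x (suc m)))

  low : ∀ {A : Set} → Str (PF x) A → A → Bool
  low s a = proj₁ s a ≤ᵇ x₁

  no-low⇒empty : ∀ {A : Set} {N} (s : Str (PF x) A) (e : Fin N ↔ A) → countFin N (low s ∘ to e) ≡ 0 → ¬ A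
  no-low⇒empty {N = zero}  s       e _  a = ¬Fin0 (from e a)
  no-low⇒empty {N = suc N} (_ , ok) e eq _ =
    contradiction (subst (1 ≤_) eq (proj₂ ok (suc N) e 1 ≤-refl (s≤s z≤n))) λ ()

  module Decompose {A : Set} (f : A → ℕ) (ok : IsParking x f) {N} (e : Fin N ↔ A) (m : ℕ)
                   (lowCount : countFin N (λ i → f (to e i) ≤ᵇ x₁) ≡ suc m) where

    P : A → Bool
    P a = f a ≤ᵇ x₁

    open Threshold f P (λ _ → refl) public

    lowEnum : Fin (suc m) ↔ Sub A P true
    lowEnum = subst (λ c → Fin c ↔ Sub A P true) lowCount (enumSub-true e P)

    lowPart : Str (Epow x₁) (Sub A P true)
    lowPart = encode x₁ (f ∘ proj₁) (proj₁ ok ∘ proj₁) low≤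

    decode-lowPart : ∀ c → decode x₁ lowPart c ≡ f (proj₁ c)
    decode-lowPart = decode-encode x₁ (f ∘ proj₁) (proj₁ ok ∘ proj₁) low≤

    structure : Str Decomposed A
    structure = inj₂ (m , P , (lowEnum , lowPart) , (high , parking⇒high-parking lowEnum ok))

  -- The number c of low points is abstracted with its defining equation, so that the
  -- index m of the ⨁-summand is a variable on which the proofs below can match.
  decompose : ∀ {A : Set} {N} (e : Fin N ↔ A) (s : Str (PF x) A) c → countFin N (low s ∘ to e) ≡ c →
              Str Decomposed A
  decompose {A} e s    zero    eq = inj₁ (Fin0↔ ¬A , Epow-empty x₁ ¬A)
    where
    ¬A : ¬ A
    ¬A = no-low⇒empty s e eq
  decompose e (f , ok) (suc m) eq = Decompose.structure f ok e m eq

  module Glue {A : Set} (m : ℕ) (P : A → Bool) (lowPart : Str (Epow x₁) (Sub A P true))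
              (g : Sub A P false → ℕ) (ok : IsParking (shift x (suc m)) g) where

    f : A → ℕ
    f = [ decode x₁ lowPart , (λ c → g c + x₁) ]′ ∘ split P

    f-low : ∀ {a} (p : P a ≡ true) → f a ≡ decode x₁ lowPart (a , p)
    f-low p = cong [ decode x₁ lowPart , (λ c → g c + x₁) ]′ (split-true P p)

    f-high : ∀ {a} (p : P a ≡ false) → f a ≡ g (a , p) + x₁
    f-high p = cong [ decode x₁ lowPart , (λ c → g c + x₁) ]′ (split-false P p)

    P≡low : ∀ a → (f a ≤ᵇ x₁) ≡ P a
    P≡low a with true-or-false (P a)
    ... | inj₁ p = trans (cong (_≤ᵇ x₁) (f-low p))
                         (trans (≤⇒≤ᵇ≡true (decode-≤ x₁ lowPart (a , p))) (sym p))
    ... | inj₂ p = trans (cong (_≤ᵇ x₁) (f-high p))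
                         (trans (>⇒≤ᵇ≡false (+-monoˡ-≤ x₁ (proj₁ ok (a , p)))) (sym p))

    positive : ∀ a → 1 ≤ f a
    positive a with true-or-false (P a)
    ... | inj₁ p = subst (1 ≤_) (sym (f-low p)) (decode-positive x₁ lowPart (a , p))
    ... | inj₂ p = subst (1 ≤_) (sym (f-high p)) (≤-trans (proj₁ ok (a , p)) (m≤m+n _ x₁))

    open Threshold f P P≡low

    high≗g : ∀ c → high c ≡ g c
    high≗g (a , p) = trans (cong (_∸ x₁) (f-high p)) (m+n∸n≡m (g (a , p)) x₁)

    parking : Fin (suc m) ↔ Sub A P true → IsParking x f
    parking lowEnum = high-parking⇒parking lowEnum positive (IsParking-cong (sym ∘ high≗g) ok)

  glue : ∀ {A : Set} → Str Decomposed A → Str (PF x) A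
  glue (inj₁ (e₀ , _)) = empty-parking x (¬Fin0 ∘ from e₀)
  glue (inj₂ (m , P , (lowEnum , lowPart) , (g , ok))) = f , parking lowEnum
    where open Glue m P lowPart g ok

  ≈-inj₂ : ∀ {A : Set} {m} {P P' : A → Bool} {eS eS' sE sE' g g' ok ok'} →
           (∀ a → P a ≡ P' a) →
           (∀ a p p' → decode x₁ sE (a , p) ≡ decode x₁ sE' (a , p')) →
           (∀ a p p' → g (a , p) ≡ g' (a , p')) →
           _≈_ Decomposed (inj₂ (m , P , (eS , sE) , (g , ok))) (inj₂ (m , P' , (eS' , sE') , (g' , ok')))
  ≈-inj₂ {sE = sE} {sE'} P≗P' low≡ high≡ = same (P≗P' ,
    decode≡⇒≈ x₁ _ sE' (λ (a , p) → trans (decode-tr x₁ (subEq true P≗P') sE (a , p)) (low≡ a _ p)) ,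
    λ (a , p) → high≡ a _ p)

  decompose-cong : ∀ {A : Set} {N} (e : Fin N ↔ A) {s s'} → _≈_ (PF x) s s' →
                   ∀ {c c'} eq eq' → c ≡ c' → _≈_ Decomposed (decompose e s c eq) (decompose e s' c' eq')
  decompose-cong e {s} _ {zero} eq _ refl = ≈-empty x₁ (no-low⇒empty s e eq) _ _
  decompose-cong e {f , ok} {f' , ok'} f≗f' {suc m} eq eq' refl =
    ≈-inj₂ (λ a → cong (_≤ᵇ x₁) (f≗f' a))
           (λ a p p' → trans (D.decode-lowPart (a , p)) (trans (f≗f' a) (sym (D'.decode-lowPart (a , p')))))
           (λ a _ _ → cong (_∸ x₁) (f≗f' a))
    where
    module D  = Decompose f  ok  e m eq
    module D' = Decompose f' ok' e m eq'

  glue-cong : ∀ {A : Set} {t t' : Str Decomposed A} → _≈_ Decomposed t t' → _≈_ (PF x) (glue t) (glue t')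
  glue-cong {t = inj₁ (e₀ , _)} {inj₁ _} _ a = ⊥-elim (¬Fin0 (from e₀ a))
  glue-cong {t = inj₂ (m , P , (eS , sE) , (g , ok))} {inj₂ (_ , P' , (eS' , sE') , (g' , ok'))}
            (same (P≗P' , sE≈ , g≈)) = f≗f'
    where
    module G  = Glue m P  sE  g  ok
    module G' = Glue m P' sE' g' ok'
    f≗f' : ∀ a → G.f a ≡ G'.f a
    f≗f' a with true-or-false (P a)
    ... | inj₁ p = begin
      G.f a                                                  ≡⟨ G.f-low p ⟩
      decode x₁ sE (a , p)                                   ≡⟨ cong (decode x₁ sE) (Sub-≡ refl) ⟩
      decode x₁ sE (from (subEq true P≗P') (a , p'))         ≡⟨ decode-tr x₁ (subEq true P≗P') sE (a , p') ⟨
      decode x₁ (tr (Epow x₁) (subEq true P≗P') sE) (a , p') ≡⟨ ≈⇒decode≡ x₁ sE≈ (a , p') ⟩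
      decode x₁ sE' (a , p')                                 ≡⟨ G'.f-low p' ⟨
      G'.f a                                                 ∎
      where
      open ≡-Reasoning
      p' : P' a ≡ true
      p' = trans (sym (P≗P' a)) p
    ... | inj₂ p = begin
      G.f a                                     ≡⟨ G.f-high p ⟩
      g (a , p) + x₁                            ≡⟨ cong (λ c → g c + x₁) (Sub-≡ refl) ⟩
      g (from (subEq false P≗P') (a , p')) + x₁ ≡⟨ cong (_+ x₁) (g≈ (a , p')) ⟩
      g' (a , p') + x₁                          ≡⟨ G'.f-high p' ⟨
      G'.f a                                    ∎
      where
      open ≡-Reasoning
      p' : P' a ≡ false
      p' = trans (sym (P≗P' a)) p

  glue-decompose : ∀ {A : Set} {N} (e : Fin N ↔ A) (s : Str (PF x) A) {c} eq →
                   _≈_ (PF x) (glue (decompose e s c eq)) s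
  glue-decompose e s        {zero}  eq a = ⊥-elim (no-low⇒empty s e eq a)
  glue-decompose e (f , ok) {suc m} eq = glued≗f
    where
    module D = Decompose f ok e m eq
    module G = Glue m D.P D.lowPart D.high (D.parking⇒high-parking D.lowEnum ok)
    glued≗f : ∀ a → G.f a ≡ f a
    glued≗f a with true-or-false (f a ≤ᵇ x₁)
    ... | inj₁ p = trans (G.f-low p) (D.decode-lowPart (a , p))
    ... | inj₂ p = trans (G.f-high p) (m∸n+n≡m (<⇒≤ (D.high> (a , p))))

  decompose-glue : ∀ {A : Set} {N} (e : Fin N ↔ A) (t : Str Decomposed A) {c} eq →
                   _≈_ Decomposed (decompose e (glue t) c eq) t
  decompose-glue e (inj₁ (e₀ , _)) {zero}  eq = ≈-empty x₁ (¬Fin0 ∘ from e₀) _ _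
  decompose-glue e t@(inj₁ (e₀ , _)) {suc m} eq = ⊥-elim (¬Fin0 (from e₀ (proj₁ (to D.lowEnum fzero))))
    where module D = Decompose (proj₁ (glue t)) (proj₂ (glue t)) e m eq
  decompose-glue {N = N} e (inj₂ (m , P , (eS , sE) , (g , ok))) eq =
    aligned eq (trans (sym eq) lowCount)
    where
    module G = Glue m P sE g ok
    lowCount : countFin N (λ i → G.f (to e i) ≤ᵇ x₁) ≡ suc m
    lowCount = trans (countFin-cong N (G.P≡low ∘ to e)) (↔⇒≡ (↔-sym eS ↔-∘ enumSub-true e P))
    aligned : ∀ {c} (eq : countFin N (λ i → G.f (to e i) ≤ᵇ x₁) ≡ c) → c ≡ suc m →
              _≈_ Decomposed (decompose e (G.f , G.parking eS) c eq) (inj₂ (m , P , (eS , sE) , (g , ok)))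
    aligned eq refl = ≈-inj₂ G.P≡low
      (λ a p p' → trans (D.decode-lowPart (a , p)) (G.f-low p'))
      (λ a _ p' → G.high≗g (a , p'))
      where module D = Decompose G.f (G.parking eS) e m eq

  decompose-tr : ∀ {A B : Set} {NA NB} (eA : Fin NA ↔ A) (eB : Fin NB ↔ B) (σ : A ↔ B) (s : Str (PF x) A) →
                 ∀ {cA cB} eqA eqB → cB ≡ cA →
                 _≈_ Decomposed (decompose eB (tr (PF x) σ s) cB eqB) (tr Decomposed σ (decompose eA s cA eqA))
  decompose-tr eA eB σ s {zero} eqA eqB refl = ≈-empty x₁ (no-low⇒empty s eA eqA ∘ from σ) _ _
  decompose-tr eA eB σ s@(f , ok) {suc m} eqA eqB refl = ≈-inj₂ (λ _ → refl)
    (λ b p p' → begin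
      decode x₁ DB.lowPart (b , p)
        ≡⟨ DB.decode-lowPart (b , p) ⟩
      f (from σ b)
        ≡⟨ DA.decode-lowPart (from σ b , p') ⟨
      decode x₁ DA.lowPart (from σ b , p')
        ≡⟨ decode-tr x₁ (subTr σ DA.P true) DA.lowPart (b , p') ⟨
      decode x₁ (tr (Epow x₁) (subTr σ DA.P true) DA.lowPart) (b , p')
        ∎)
    (λ _ _ _ → refl)
    where
    open ≡-Reasoning
    module DA = Decompose f ok eA m eqA
    module DB = Decompose (proj₁ (tr (PF x) σ s)) (proj₂ (tr (PF x) σ s)) eB m eqB

  PF≅Decomposed : PF x ≅ˢ Decomposed
  PF≅Decomposed = record
    { φ       = λ U s → decompose (enum U) s _ refl
    ; ψ       = λ _ → glue
    ; φ-cong  = λ U {s} {s'} s≈s' → decompose-cong (enum U) s≈s' refl refl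
                  (countFin-cong (size U) (λ i → cong (_≤ᵇ x₁) (s≈s' (to (enum U) i))))
    ; ψ-cong  = λ _ {t} {t'} → glue-cong {t = t} {t'}
    ; ψφ      = λ U s → glue-decompose (enum U) s refl
    ; φψ      = λ U t → decompose-glue (enum U) t refl
    ; natural = λ U V σ s → decompose-tr (enum U) (enum V) σ s refl refl
                  (countFin-↔ (↔-sym σ ↔-∘ enum V) (enum U) (low s))
    }

theorem1 : (x : ℕ → ℕ) → NonDecreasing x →
    PF x ≅ˢ (Restr (Epow (x 1)) 0 ⊕ ⨁ (λ m → Restr (Epow (x 1)) (suc m) ⊙ PF (shift x (suc m))))
theorem1 x mono = Parking.PF≅Decomposed x mono
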